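{- Let $S$ and $T$ be association schemes on finite sets $X$ and $Y$, and $\phi$ an admissible morphism from $S$ to $T$. Then $\ker\phi$ is a normal closed subset of $S$.
   Context: An association scheme on a finite set $X$ is a partition $S$ of $X\times X$ into nonempty subsets such that $1_X=\{(x,x)\}\in S$; $s^*=\{(x,y):(y,x)\in s\}\in S$; and for $p,q,r\in S$ there is $a_{pq}^r\ge0$ with $|\{y:(x,y)\in p,(y,z)\in q\}|=a_{pq}^r$ whenever $(x,z)\in r$. Complex product: $PQ=\{r:a_{pq}^r>0\text{ for some }p\in P,q\in Q\}$, $pQ=\{p\}Q$. A nonempty $K\subseteq S$ is closed if $KK=K$, and normal if $pK=Kp$ for all $p\in S$. A morphism from $S$ on $X$ to $T$ on $Y$ is a function $\phi:X\cup S\to Y\cup T$ with $\phi(X)\subseteq Y$, $\phi(S)\subseteq T$, $(\phi(x_1),\phi(x_2))\in\phi(s)$ whenever $(x_1,x_2)\in s$; it is admissible if whenever $(\phi(x),y)\in\phi(s)$ there is $x'\in X$ with $\phi(x')=y$ and $(x,x')\in s$. $\ker\phi=\{s\in S:\phi(s)=1_Y\}$. -}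

module Defs where

open import Data.Nat using (ℕ; _<_)
open import Data.Fin using (Fin; _≟_)
open import Data.List using (length; filter; allFin)
open import Data.Product using (Σ; ∃; ∃-syntax; _×_; _,_)
open import Relation.Nullary using (¬_)
open import Relation.Nullary.Decidable using (_×-dec_)
open import Relation.Unary using (Decidable)
open import Relation.Binary.PropositionalEquality using (_≡_)
open import Function.Bundles using (_⇔_)

count : ∀ {n} (P : Fin n → Set) → Decidable P → ℕ
count {n} P P? = length (filter P? (allFin n))

-- An association scheme on the finite set X = Fin pts whose relations
-- (the members of the partition S) are indexed by Fin cls.
-- rel x y is the (index of the) unique member of S containing (x , y).
record AssocScheme : Set₁ where
  field
    pts  : ℕ
    cls  : ℕ
    rel  : Fin pts → Fin pts → Fin cls
    nonempty : ∀ (s : Fin cls) → ∃[ x ] ∃[ y ] rel x y ≡ s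
    one      : Fin cls
    one-diag : ∀ x y → (rel x y ≡ one) ⇔ (x ≡ y)
    star     : Fin cls → Fin cls
    star-spec : ∀ s x y → (rel x y ≡ star s) ⇔ (rel y x ≡ s)
    a        : Fin cls → Fin cls → Fin cls → ℕ
    a-spec   : ∀ p q r x z → rel x z ≡ r →
               count (λ y → rel x y ≡ p × rel y z ≡ q)
                     (λ y → (rel x y ≟ p) ×-dec (rel y z ≟ q))
               ≡ a p q r

module _ (S : AssocScheme) where
  open AssocScheme S

  Subset : Set₁
  Subset = Fin cls → Set

  _⊙_ : Subset → Subset → Subset
  (P ⊙ Q) r = ∃[ p ] ∃[ q ] (P p × Q q × 0 < a p q r)

  -- pQ = {p}Q
  single : Fin cls → Subset
  single p s = s ≡ p

  _≐_ : Subset → Subset → Set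
  P ≐ Q = ∀ r → P r ⇔ Q r

  IsClosed : Subset → Set
  IsClosed K = (∃[ k ] K k) × ((K ⊙ K) ≐ K)

  IsNormal : Subset → Set
  IsNormal K = ∀ p → (single p ⊙ K) ≐ (K ⊙ single p)

-- a morphism S → T: phi restricted to X and to S
record Morphism (S T : AssocScheme) : Set where
  private
    module S = AssocScheme S
    module T = AssocScheme T
  field
    φX : Fin S.pts → Fin T.pts
    φS : Fin S.cls → Fin T.cls
    preserves : ∀ x₁ x₂ → T.rel (φX x₁) (φX x₂) ≡ φS (S.rel x₁ x₂)

IsAdmissible : ∀ {S T} → Morphism S T → Set
IsAdmissible {S} {T} φ =
  ∀ x s y → T.rel (φX x) y ≡ φS s → ∃[ x' ] (φX x' ≡ y × S.rel x x' ≡ s)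
  where
    module S = AssocScheme S
    module T = AssocScheme T
    open Morphism φ

ker : ∀ {S T} → Morphism S T → Subset S
ker {S} {T} φ s = Morphism.φS φ s ≡ AssocScheme.one T

-- Everything is reduced to statements about points.  Every relation r of
-- a scheme has a representative pair (x , z) with rel x z ≡ r, and the
-- intersection numbers turn membership in a complex product into a path:
--     r ∈ P Q   iff   ∃ y. P (rel x y) and Q (rel y z)      (⊙-rel).
-- For a morphism φ, a relation rel x y lies in ker φ iff φ x ≡ φ y.
-- Hence (ker φ)(ker φ) consists of the relations whose endpoints have
-- equal images, i.e. ker φ itself; this needs no admissibility.  For
-- normality, p·ker φ and ker φ·p are paths "p-step then φ-equal step"
-- and "φ-equal step then p-step"; admissibility lets us lift a p-step
-- along a φ-equal point (lift-step), which converts one kind of path into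
-- the other, using s* to reverse the step in one direction.
module Submission where

open import Defs
open import Data.Nat using (_<_; s≤s; z≤n)
open import Data.Fin using (Fin)
open import Data.List using (List; []; _∷_; length; filter; allFin)
open import Data.List.Relation.Unary.Any using (here; there)
open import Data.List.Membership.Propositional using (_∈_)
open import Data.List.Membership.Propositional.Properties
  using (∈-filter⁺; ∈-filter⁻; ∈-allFin)
open import Data.Product using (∃; ∃-syntax; _×_; _,_; proj₂)
open import Relation.Unary using (Decidable)
open import Relation.Binary.PropositionalEquality
  using (_≡_; refl; sym; trans; cong; subst; module ≡-Reasoning)
open import Function.Bundles using (_⇔_; Equivalence; mk⇔)

open Equivalence using (to; from)

length-pos⇔nonempty : ∀ {A : Set} (l : List A) → 0 < length l ⇔ (∃[ y ] y ∈ l)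
length-pos⇔nonempty []      = mk⇔ (λ ()) (λ { (_ , ()) })
length-pos⇔nonempty (y ∷ l) = mk⇔ (λ _ → y , here refl) (λ _ → s≤s z≤n)

count-pos⇔∃ : ∀ {n} (P : Fin n → Set) (P? : Decidable P) → 0 < count P P? ⇔ ∃ P
count-pos⇔∃ {n} P P? = mk⇔
  (λ pos → let y , y∈ = to (length-pos⇔nonempty (filter P? (allFin n))) pos
           in y , proj₂ (∈-filter⁻ P? {xs = allFin n} y∈))
  (λ { (y , Py) → from (length-pos⇔nonempty _) (_ , ∈-filter⁺ P? (∈-allFin y) Py) })

module SchemeFacts (S : AssocScheme) where
  open AssocScheme S

  by-representative : {Q : Subset S} → (∀ x z → Q (rel x z)) → ∀ r → Q r
  by-representative {Q} Qrel r =
    let x , z , xz≡r = nonempty r in subst Q xz≡r (Qrel x z)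

  a-pos⇔path : ∀ p q x z → 0 < a p q (rel x z) ⇔ (∃[ y ] (rel x y ≡ p × rel y z ≡ q))
  a-pos⇔path p q x z =
    subst (λ m → 0 < m ⇔ _) (a-spec p q (rel x z) x z refl) (count-pos⇔∃ _ _)

  ⊙-rel : ∀ (P Q : Subset S) x z →
          _⊙_ S P Q (rel x z) ⇔ (∃[ y ] (P (rel x y) × Q (rel y z)))
  ⊙-rel P Q x z = mk⇔ path product
    where
    path : _⊙_ S P Q (rel x z) → ∃[ y ] (P (rel x y) × Q (rel y z))
    path (p , q , Pp , Qq , pos) with to (a-pos⇔path p q x z) pos
    ... | y , refl , refl = y , Pp , Qq
    product : ∃[ y ] (P (rel x y) × Q (rel y z)) → _⊙_ S P Q (rel x z)
    product (y , Pxy , Qyz) =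
      rel x y , rel y z , Pxy , Qyz , from (a-pos⇔path _ _ x z) (y , refl , refl)

  rel-swap : ∀ {x y x' y'} → rel x y ≡ rel x' y' → rel y x ≡ rel y' x'
  rel-swap {x} {y} {x'} {y'} eq =
    trans (reversed x y refl) (sym (reversed x' y' (sym eq)))
    where
    reversed : ∀ u v → rel u v ≡ rel x y → rel v u ≡ star (rel x y)
    reversed u v = from (star-spec (rel x y) v u)

module MorphismFacts {S T : AssocScheme} (φ : Morphism S T) where
  private
    module S = AssocScheme S
    module T = AssocScheme T
  open Morphism φ
  open SchemeFacts S using (by-representative; ⊙-rel; rel-swap)

  ker-rel : ∀ x y → ker φ (S.rel x y) ⇔ φX x ≡ φX y
  ker-rel x y = mk⇔
    (λ k → to (T.one-diag _ _) (trans (preserves x y) k))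
    (λ eq → trans (sym (preserves x y)) (from (T.one-diag _ _) eq))

  -- The kernel of any morphism is closed: paths inside ker φ stay in
  -- one fibre of φ, and every kernel relation is such a path of length 2.
  ker-closed : IsClosed S (ker φ)
  ker-closed = (S.one , one∈ker) , by-representative closure
    where
    one∈ker : ker φ S.one
    one∈ker = let x , y , xy≡one = S.nonempty S.one
              in subst (ker φ) xy≡one
                   (from (ker-rel x y) (cong φX (to (S.one-diag x y) xy≡one)))
    closure : ∀ x z → _⊙_ S (ker φ) (ker φ) (S.rel x z) ⇔ ker φ (S.rel x z)
    closure x z = mk⇔
      (λ kk → let y , kxy , kyz = to (⊙-rel _ _ x z) kk
              in from (ker-rel x z) (trans (to (ker-rel x y) kxy) (to (ker-rel y z) kyz)))
      (λ kxz → from (⊙-rel _ _ x z)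
                 (z , kxz , from (ker-rel z z) refl))

  lift-step : IsAdmissible φ → ∀ {x x'} z → φX x ≡ φX x' →
              ∃[ z' ] (φX z' ≡ φX z × S.rel x z' ≡ S.rel x' z)
  lift-step adm {x} {x'} z φx≡φx' = adm x (S.rel x' z) (φX z) image-step
    where
    open ≡-Reasoning
    image-step : T.rel (φX x) (φX z) ≡ φS (S.rel x' z)
    image-step = begin
      T.rel (φX x)  (φX z) ≡⟨ cong (λ u → T.rel u (φX z)) φx≡φx' ⟩
      T.rel (φX x') (φX z) ≡⟨ preserves x' z ⟩
      φS (S.rel x' z)      ∎

  -- The kernel of an admissible morphism is normal: a p-step followed by
  -- a kernel step can be replaced by a kernel step followed by a p-step,
  -- and conversely, by lifting the p-step (reversed, for one direction).
  ker-normal : IsAdmissible φ → IsNormal S (ker φ)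
  ker-normal adm p = by-representative commute
    where
    step-then-ker : ∀ x z → ∃[ y ] (S.rel x y ≡ p × φX y ≡ φX z) →
                    ∃[ y ] (φX x ≡ φX y × S.rel y z ≡ p)
    step-then-ker x z (y , xy≡p , φy≡φz) =
      let x' , φx'≡φx , zx'≡yx = lift-step adm x (sym φy≡φz)
      in x' , sym φx'≡φx , trans (rel-swap zx'≡yx) xy≡p
    ker-then-step : ∀ x z → ∃[ y ] (φX x ≡ φX y × S.rel y z ≡ p) →
                    ∃[ y ] (S.rel x y ≡ p × φX y ≡ φX z)
    ker-then-step x z (y , φx≡φy , yz≡p) =
      let z' , φz'≡φz , xz'≡yz = lift-step adm z φx≡φy
      in z' , trans xz'≡yz yz≡p , φz'≡φz
    commute : ∀ x z → _⊙_ S (single S p) (ker φ) (S.rel x z)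
                    ⇔ _⊙_ S (ker φ) (single S p) (S.rel x z)
    commute x z = mk⇔
      (λ pk → let y , xy≡p , kyz = to (⊙-rel _ _ x z) pk
                  y' , φx≡φy' , y'z≡p = step-then-ker x z (y , xy≡p , to (ker-rel y z) kyz)
              in from (⊙-rel _ _ x z) (y' , from (ker-rel x y') φx≡φy' , y'z≡p))
      (λ kp → let y , kxy , yz≡p = to (⊙-rel _ _ x z) kp
                  y' , xy'≡p , φy'≡φz = ker-then-step x z (y , to (ker-rel x y) kxy , yz≡p)
              in from (⊙-rel _ _ x z) (y' , xy'≡p , from (ker-rel y' z) φy'≡φz))

lemma4p3 : (S T : AssocScheme) (φ : Morphism S T) → IsAdmissible φ →
    IsClosed S (ker φ) × IsNormal S (ker φ)
lemma4p3 S T φ adm = ker-closed , ker-normal adm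
  where open MorphismFacts φ
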